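{- The operation $\boxplus$ is associative on $\mathcal{A}_k$: for all $A_1,A_2,A_3\in\mathcal{A}_k$, \[(A_1\boxplus A_2)\boxplus A_3=\mathrm{abs}(A_1\oplus A_2\oplus A_3)=A_1\boxplus(A_2\boxplus A_3).\] Hence $(\mathcal{A}_k,\boxplus)$ is a semigroup.
   Context: Let $k$ be a positive integer. A $k$-interface graph is a tuple $(G,\phi,L,R)$ where $G$ is a finite simple graph, $L,R\subseteq V(G)$, and $\phi:V(G)\to[k]$ is injective on each of $L$ and $R$. Two $k$-interface graphs $(G_1,\phi_1,L_1,R_1)$, $(G_2,\phi_2,L_2,R_2)$ are compatible if, with $J=\phi_1(R_1)\cap\phi_2(L_2)$, we have $V(G_1)\cap V(G_2)=\phi_1^{ -1}(J)\cap R_1=\phi_2^{ -1}(J)\cap L_2$ and $\phi_1,\phi_2$ coincide on $V(G_1)\cap V(G_2)$; their gluing is $(G_1\cup G_2,\phi,L_1,R_2)$ with $\phi$ the common extension of $\phi_1,\phi_2$. A sequence $\mathbb{G}_1,\dots,\mathbb{G}_n$ is compatible if consecutive terms are compatible and any vertex in $V(G_i)\cap V(G_\ell)$ lies in $V(G_j)$ for $i<j<\ell$. Isomorphism of $k$-interface graphs is a graph isomorphism preserving labels, membership in $L$ and in $R$; $\mathcal{I}_k$ is the set of isomorphism classes, and for $I_1,I_2\in\mathcal{I}_k$, $I_1\oplus I_2$ is the class of the gluing of compatible representatives (this makes $(\mathcal{I}_k,\oplus)$ a semigroup). The torso $\mathrm{torso}(G,X)$ is the graph on $X$ where $x_1\neq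 x_2$ are adjacent iff they are joined in $G$ by a path whose internal vertices are not in $X$. The abstraction $\mathrm{abs}(\mathbb{G})$ of $\mathbb{G}=(G,\phi,L,R)$ is the isomorphism class of $(\mathrm{torso}(G,L\cup R),\phi|_{L\cup R},L,R)$; for $I\in\mathcal{I}_k$, $\mathrm{abs}(I)$ is the abstraction of any representative. $\mathcal{A}_k\subseteq\mathcal{I}_k$ is the set of all abstractions of $k$-interface graphs, and for $A_1,A_2\in\mathcal{A}_k$, $A_1\boxplus A_2:=\mathrm{abs}(A_1\oplus A_2)$. -}

module Defs where

open import Data.Nat using (ℕ; _≟_)
open import Data.Fin using (Fin)
open import Data.List using (List; _++_)
open import Data.List.Membership.DecPropositional _≟_ using (_∈_; _∉_; _∈?_)
open import Data.Product using (Σ; Σ-syntax; ∃; ∃-syntax; _×_; _,_)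
open import Relation.Nullary using (¬_; yes; no; Dec)
open import Data.Sum using (_⊎_)
open import Relation.Binary.PropositionalEquality using (_≡_; _≢_)
open import Function.Bundles using (_⇔_)
open import Level using () renaming (suc to lsuc; zero to lzero)

-- Vertices are drawn from the common universe ℕ (so that intersections and
-- unions of vertex sets of different graphs make sense).

record IGraph (k : ℕ) : Set₁ where
  field
    V : List ℕ
    E : ℕ → ℕ → Set
    φ : ℕ → Fin k
    L : List ℕ
    R : List ℕ
open IGraph public

record IsIGraph {k : ℕ} (G : IGraph k) : Set where
  field
    edge-in-V : ∀ x y → E G x y → (x ∈ V G) × (y ∈ V G)
    sym       : ∀ x y → E G x y → E G y x
    irrefl    : ∀ x → ¬ E G x x
    L⊆V       : ∀ x → x ∈ L G → x ∈ V G
    R⊆V       : ∀ x → x ∈ R G → x ∈ V G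
    inj-L     : ∀ x y → x ∈ L G → y ∈ L G → φ G x ≡ φ G y → x ≡ y
    inj-R     : ∀ x y → x ∈ R G → y ∈ R G → φ G x ≡ φ G y → x ≡ y

record _≅_ {k : ℕ} (G₁ G₂ : IGraph k) : Set where
  field
    f      : ℕ → ℕ
    g      : ℕ → ℕ
    f-V    : ∀ x → x ∈ V G₁ → f x ∈ V G₂
    g-V    : ∀ y → y ∈ V G₂ → g y ∈ V G₁
    gf     : ∀ x → x ∈ V G₁ → g (f x) ≡ x
    fg     : ∀ y → y ∈ V G₂ → f (g y) ≡ y
    f-E    : ∀ x y → x ∈ V G₁ → y ∈ V G₁ → E G₁ x y ⇔ E G₂ (f x) (f y)
    f-φ    : ∀ x → x ∈ V G₁ → φ G₂ (f x) ≡ φ G₁ x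
    f-L    : ∀ x → x ∈ V G₁ → (x ∈ L G₁) ⇔ (f x ∈ L G₂)
    f-R    : ∀ x → x ∈ V G₁ → (x ∈ R G₁) ⇔ (f x ∈ R G₂)

InJ : {k : ℕ} → IGraph k → IGraph k → Fin k → Set
InJ G₁ G₂ c = (∃[ r ] (r ∈ R G₁ × φ G₁ r ≡ c)) × (∃[ l ] (l ∈ L G₂ × φ G₂ l ≡ c))

record Compatible {k : ℕ} (G₁ G₂ : IGraph k) : Set where
  field
    cap-R : ∀ v → ((v ∈ V G₁) × (v ∈ V G₂)) ⇔ ((v ∈ R G₁) × InJ G₁ G₂ (φ G₁ v))
    cap-L : ∀ v → ((v ∈ V G₁) × (v ∈ V G₂)) ⇔ ((v ∈ L G₂) × InJ G₁ G₂ (φ G₂ v))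
    φ-agree : ∀ v → v ∈ V G₁ → v ∈ V G₂ → φ G₁ v ≡ φ G₂ v

glue : {k : ℕ} → IGraph k → IGraph k → IGraph k
glue G₁ G₂ = record
  { V = V G₁ ++ V G₂
  ; E = λ x y → E G₁ x y ⊎ E G₂ x y
  ; φ = λ v → extend (v ∈? V G₁) v
  ; L = L G₁
  ; R = R G₂
  }
  where
    extend : ∀ {v} → Dec (v ∈ V G₁) → ℕ → Fin _
    extend (yes _) v = φ G₁ v
    extend (no _)  v = φ G₂ v

record CompatibleSeq3 {k : ℕ} (G₁ G₂ G₃ : IGraph k) : Set where
  field
    c₁₂ : Compatible G₁ G₂
    c₂₃ : Compatible G₂ G₃
    mid : ∀ v → v ∈ V G₁ → v ∈ V G₃ → v ∈ V G₂

data OutsidePath {k : ℕ} (G : IGraph k) (X : List ℕ) : ℕ → ℕ → Set where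
  edge : ∀ {x y} → E G x y → OutsidePath G X x y
  step : ∀ {x z y} → E G x z → z ∈ V G → z ∉ X → OutsidePath G X z y →
         OutsidePath G X x y

abs : {k : ℕ} → IGraph k → IGraph k
abs G = record
  { V = L G ++ R G
  ; E = λ x y → (x ∈ L G ++ R G) × (y ∈ L G ++ R G) × (x ≢ y) ×
                OutsidePath G (L G ++ R G) x y
  ; φ = φ G
  ; L = L G
  ; R = R G
  }

-- Operations on isomorphism classes, as relations on representatives.

InAbs : {k : ℕ} → IGraph k → Set₁
InAbs {k} A = Σ (IGraph k) (λ G → IsIGraph G × (A ≅ abs G))

BoxSum : {k : ℕ} → IGraph k → IGraph k → IGraph k → Set₁
BoxSum {k} A B C =
  Σ (IGraph k) λ A' → Σ (IGraph k) λ B' →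
    IsIGraph A' × IsIGraph B' × (A' ≅ A) × (B' ≅ B) ×
    Compatible A' B' × (abs (glue A' B') ≅ C)

AbsSum3 : {k : ℕ} → IGraph k → IGraph k → IGraph k → IGraph k → Set₁
AbsSum3 {k} A₁ A₂ A₃ C =
  Σ (IGraph k) λ H₁ → Σ (IGraph k) λ H₂ → Σ (IGraph k) λ H₃ →
    IsIGraph H₁ × IsIGraph H₂ × IsIGraph H₃ ×
    (H₁ ≅ A₁) × (H₂ ≅ A₂) × (H₃ ≅ A₃) ×
    CompatibleSeq3 H₁ H₂ H₃ × (abs (glue (glue H₁ H₂) H₃) ≅ C)

-- Gluing and abstraction respect isomorphism, so ⊞ may be computed on
-- any compatible representatives; gluing is associative; and abs(abs G ⊕ H) ≅ abs(G ⊕ H), because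
-- G meets H only in interface vertices of G: a path of G ⊕ H with interior outside the interface
-- splits into H-edges and stretches through G between interface vertices of G, which are exactly
-- the edges of the torso of G.
module Submission where

open import Defs
open import Data.Nat using (ℕ; _<_; _≟_)
open import Data.List using (List; _++_)
open import Data.List.Properties using (++-assoc)
open import Data.List.Membership.DecPropositional _≟_ using (_∈_; _∉_; _∈?_)
open import Data.List.Membership.Propositional.Properties using (∈-++⁺ˡ; ∈-++⁺ʳ; ∈-++⁻; ++-∈⇔)
open import Data.List.Relation.Binary.Permutation.Propositional.Properties using (∈-resp-↭; ++-comm)
open import Data.Product using (_×_; _,_; proj₁; proj₂; map)
open import Data.Product.Function.NonDependent.Propositional using (_×-⇔_)
open import Data.Sum using (_⊎_; inj₁; inj₂; [_,_]′; swap; assocʳ; assocˡ)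
open import Data.Sum.Function.Propositional using (_⊎-⇔_)
open import Data.Empty using (⊥-elim)
open import Function using (_∘_; id)
open import Function.Bundles using (_⇔_; mk⇔; Equivalence)
open import Function.Properties.Equivalence using ()
  renaming (refl to ⇔-refl; sym to ⇔-sym; trans to ⇔-trans)
open import Function.Related.Propositional using (≡⇒)
open import Relation.Nullary using (¬_; Dec; yes; no)
open import Relation.Binary.PropositionalEquality
  using (_≡_; _≢_; refl; sym; trans; cong; cong₂; subst; subst₂; module ≡-Reasoning)

open Equivalence using (to; from)

module _ {k : ℕ} where

  φ-glue-∉ : (G H : IGraph k) → ∀ v → v ∉ V G → φ (glue G H) v ≡ φ H v
  φ-glue-∉ G H v v∉G with v ∈? V G
  ... | yes v∈G = ⊥-elim (v∉G v∈G)
  ... | no  _   = refl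

  φ-glueˡ : (G H : IGraph k) → ∀ v → v ∈ V G → φ (glue G H) v ≡ φ G v
  φ-glueˡ G H v v∈G with v ∈? V G
  ... | yes _   = refl
  ... | no  v∉G = ⊥-elim (v∉G v∈G)

  φ-glueʳ : (G H : IGraph k) → Compatible G H → ∀ v → v ∈ V H → φ (glue G H) v ≡ φ H v
  φ-glueʳ G H c v v∈H with v ∈? V G
  ... | yes v∈G = Compatible.φ-agree c v v∈G v∈H
  ... | no  _   = refl

  ≅-sym : {G₁ G₂ : IGraph k} → G₁ ≅ G₂ → G₂ ≅ G₁
  ≅-sym {G₁} {G₂} i = record
    { f = g ; g = f ; f-V = g-V ; g-V = f-V ; gf = fg ; fg = gf
    ; f-E = λ x y x∈ y∈ → ⇔-sym (⇔-trans (f-E (g x) (g y) (g-V x x∈) (g-V y y∈))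
                                          (≡⇒ (cong₂ (E G₂) (fg x x∈) (fg y y∈))))
    ; f-φ = λ y y∈ → trans (sym (f-φ (g y) (g-V y y∈))) (cong (φ G₂) (fg y y∈))
    ; f-L = λ y y∈ → ⇔-sym (⇔-trans (f-L (g y) (g-V y y∈)) (≡⇒ (cong (_∈ L G₂) (fg y y∈))))
    ; f-R = λ y y∈ → ⇔-sym (⇔-trans (f-R (g y) (g-V y y∈)) (≡⇒ (cong (_∈ R G₂) (fg y y∈))))
    }
    where open _≅_ i

  ≅-trans : {G₁ G₂ G₃ : IGraph k} → G₁ ≅ G₂ → G₂ ≅ G₃ → G₁ ≅ G₃
  ≅-trans i j = record
    { f = J.f ∘ I.f ; g = I.g ∘ J.g
    ; f-V = λ x x∈ → J.f-V _ (I.f-V x x∈)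
    ; g-V = λ z z∈ → I.g-V _ (J.g-V z z∈)
    ; gf = λ x x∈ → trans (cong I.g (J.gf _ (I.f-V x x∈))) (I.gf x x∈)
    ; fg = λ z z∈ → trans (cong J.f (I.fg _ (J.g-V z z∈))) (J.fg z z∈)
    ; f-E = λ x y x∈ y∈ → ⇔-trans (I.f-E x y x∈ y∈) (J.f-E _ _ (I.f-V x x∈) (I.f-V y y∈))
    ; f-φ = λ x x∈ → trans (J.f-φ _ (I.f-V x x∈)) (I.f-φ x x∈)
    ; f-L = λ x x∈ → ⇔-trans (I.f-L x x∈) (J.f-L _ (I.f-V x x∈))
    ; f-R = λ x x∈ → ⇔-trans (I.f-R x x∈) (J.f-R _ (I.f-V x x∈))
    }
    where
      module I = _≅_ i
      module J = _≅_ j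

  ≅-byId : {G G' : IGraph k} →
    (∀ x → x ∈ V G ⇔ x ∈ V G') → (∀ x y → E G x y ⇔ E G' x y) →
    (∀ x → x ∈ V G → φ G' x ≡ φ G x) →
    (∀ x → x ∈ L G ⇔ x ∈ L G') → (∀ x → x ∈ R G ⇔ x ∈ R G') → G ≅ G'
  ≅-byId V⇔ E⇔ φ≡ L⇔ R⇔ = record
    { f = λ x → x ; g = λ x → x
    ; f-V = λ x → to (V⇔ x) ; g-V = λ x → from (V⇔ x)
    ; gf = λ _ _ → refl ; fg = λ _ _ → refl
    ; f-E = λ x y _ _ → E⇔ x y
    ; f-φ = φ≡
    ; f-L = λ x _ → L⇔ x
    ; f-R = λ x _ → R⇔ x
    }

  ≅-injective : {G G' : IGraph k} (i : G ≅ G') → ∀ {x y} → x ∈ V G → y ∈ V G →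
                _≅_.f i x ≡ _≅_.f i y → x ≡ y
  ≅-injective i {x} {y} x∈ y∈ fx≡fy = trans (sym (gf x x∈)) (trans (cong g fx≡fy) (gf y y∈))
    where open _≅_ i

  ≅-interface : {G G' : IGraph k} (i : G ≅ G') → ∀ x → x ∈ V G →
                (x ∈ L G ++ R G) ⇔ (_≅_.f i x ∈ L G' ++ R G')
  ≅-interface i x x∈ =
    ⇔-trans ++-∈⇔ (⇔-trans (_≅_.f-L i x x∈ ⊎-⇔ _≅_.f-R i x x∈) (⇔-sym ++-∈⇔))

  interface⊆V : {G : IGraph k} → IsIGraph G → ∀ x → x ∈ L G ++ R G → x ∈ V G
  interface⊆V {G} w x x∈ with ∈-++⁻ (L G) x∈
  ... | inj₁ x∈L = IsIGraph.L⊆V w x x∈L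
  ... | inj₂ x∈R = IsIGraph.R⊆V w x x∈R

  module _ {G : IGraph k} {X : List ℕ} where

    path-join : ∀ {a b c} → OutsidePath G X a b → b ∈ V G → b ∉ X →
                OutsidePath G X b c → OutsidePath G X a c
    path-join (edge e)         b∈ b∉ q = step e b∈ b∉ q
    path-join (step e z∈ z∉ p) b∈ b∉ q = step e z∈ z∉ (path-join p b∈ b∉ q)

    path-reverse : (∀ x y → E G x y → E G y x) →
                   ∀ {a b} → OutsidePath G X a b → OutsidePath G X b a
    path-reverse E-sym (edge e)         = edge (E-sym _ _ e)
    path-reverse E-sym (step e z∈ z∉ p) =
      path-join (path-reverse E-sym p) z∈ z∉ (edge (E-sym _ _ e))

  path-map : {G G' : IGraph k} {X X' : List ℕ} →
             (∀ {x y} → E G x y → E G' x y) →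
             (∀ {z} → z ∈ V G → z ∉ X → z ∈ V G' × z ∉ X') →
             ∀ {a b} → OutsidePath G X a b → OutsidePath G' X' a b
  path-map E⇒ V⇒ (edge e)         = edge (E⇒ e)
  path-map E⇒ V⇒ (step e z∈ z∉ p) =
    step (E⇒ e) (proj₁ (V⇒ z∈ z∉)) (proj₂ (V⇒ z∈ z∉)) (path-map E⇒ V⇒ p)

  path-≅ : {G G' : IGraph k} → IsIGraph G → (i : G ≅ G') → ∀ {a b} →
           OutsidePath G (L G ++ R G) a b →
           OutsidePath G' (L G' ++ R G') (_≅_.f i a) (_≅_.f i b)
  path-≅ {G} {G'} w i = go
    where
      open _≅_ i
      ends : ∀ {x y} → E G x y → x ∈ V G × y ∈ V G
      ends = IsIGraph.edge-in-V w _ _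
      go : ∀ {a b} → OutsidePath G (L G ++ R G) a b → OutsidePath G' (L G' ++ R G') (f a) (f b)
      go (edge e) = edge (to (f-E _ _ (proj₁ (ends e)) (proj₂ (ends e))) e)
      go (step e z∈ z∉ p) =
        step (to (f-E _ _ (proj₁ (ends e)) z∈) e) (f-V _ z∈) (z∉ ∘ from (≅-interface i _ z∈)) (go p)

  abs-IsIGraph : {G : IGraph k} → IsIGraph G → IsIGraph (abs G)
  abs-IsIGraph {G} w = record
    { edge-in-V = λ { x y (x∈ , y∈ , _) → x∈ , y∈ }
    ; sym       = λ { x y (x∈ , y∈ , x≢y , p) →
                      y∈ , x∈ , x≢y ∘ sym , path-reverse (IsIGraph.sym w) p }
    ; irrefl    = λ { x (_ , _ , x≢x , _) → x≢x refl }
    ; L⊆V       = λ x → ∈-++⁺ˡ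
    ; R⊆V       = λ x → ∈-++⁺ʳ (L G)
    ; inj-L     = IsIGraph.inj-L w
    ; inj-R     = IsIGraph.inj-R w
    }

  glue-IsIGraph : {G₁ G₂ : IGraph k} → IsIGraph G₁ → IsIGraph G₂ → Compatible G₁ G₂ →
                  IsIGraph (glue G₁ G₂)
  glue-IsIGraph {G₁} {G₂} w₁ w₂ c = record
    { edge-in-V = λ { x y (inj₁ e) → map ∈-++⁺ˡ ∈-++⁺ˡ (W₁.edge-in-V x y e)
                    ; x y (inj₂ e) → map (∈-++⁺ʳ (V G₁)) (∈-++⁺ʳ (V G₁)) (W₂.edge-in-V x y e) }
    ; sym       = λ { x y (inj₁ e) → inj₁ (W₁.sym x y e) ; x y (inj₂ e) → inj₂ (W₂.sym x y e) }
    ; irrefl    = λ { x (inj₁ e) → W₁.irrefl x e ; x (inj₂ e) → W₂.irrefl x e }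
    ; L⊆V       = λ x → ∈-++⁺ˡ ∘ W₁.L⊆V x
    ; R⊆V       = λ x → ∈-++⁺ʳ (V G₁) ∘ W₂.R⊆V x
    ; inj-L     = λ x y x∈ y∈ φx≡φy → W₁.inj-L x y x∈ y∈
        (trans (sym (φ-glueˡ G₁ G₂ x (W₁.L⊆V x x∈))) (trans φx≡φy (φ-glueˡ G₁ G₂ y (W₁.L⊆V y y∈))))
    ; inj-R     = λ x y x∈ y∈ φx≡φy → W₂.inj-R x y x∈ y∈
        (trans (sym (φ-glueʳ G₁ G₂ c x (W₂.R⊆V x x∈))) (trans φx≡φy (φ-glueʳ G₁ G₂ c y (W₂.R⊆V y y∈))))
    }
    where
      module W₁ = IsIGraph w₁
      module W₂ = IsIGraph w₂

  abs-cong : {G G' : IGraph k} → IsIGraph G → IsIGraph G' → G ≅ G' → abs G ≅ abs G'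
  abs-cong {G} {G'} w w' i = record
    { f = f ; g = g
    ; f-V = λ x x∈ → to (≅-interface i x (∈V x∈)) x∈
    ; g-V = λ y y∈ → to (≅-interface (≅-sym i) y (∈V' y∈)) y∈
    ; gf = λ x x∈ → gf x (∈V x∈)
    ; fg = λ y y∈ → fg y (∈V' y∈)
    ; f-E = λ x y x∈ y∈ → mk⇔ (torso-to x∈ y∈) (torso-from x∈ y∈)
    ; f-φ = λ x x∈ → f-φ x (∈V x∈)
    ; f-L = λ x x∈ → f-L x (∈V x∈)
    ; f-R = λ x x∈ → f-R x (∈V x∈)
    }
    where
      open _≅_ i
      ∈V : ∀ {x} → x ∈ L G ++ R G → x ∈ V G
      ∈V = interface⊆V w _
      ∈V' : ∀ {y} → y ∈ L G' ++ R G' → y ∈ V G'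
      ∈V' = interface⊆V w' _
      torso-to : ∀ {x y} → x ∈ L G ++ R G → y ∈ L G ++ R G → E (abs G) x y → E (abs G') (f x) (f y)
      torso-to x∈ y∈ (_ , _ , x≢y , p) =
        to (≅-interface i _ (∈V x∈)) x∈ , to (≅-interface i _ (∈V y∈)) y∈ ,
        x≢y ∘ ≅-injective i (∈V x∈) (∈V y∈) , path-≅ w i p
      torso-from : ∀ {x y} → x ∈ L G ++ R G → y ∈ L G ++ R G → E (abs G') (f x) (f y) → E (abs G) x y
      torso-from {x} {y} x∈ y∈ (_ , _ , fx≢fy , p) =
        x∈ , y∈ , fx≢fy ∘ cong f ,
        subst₂ (OutsidePath G (L G ++ R G)) (gf x (∈V x∈)) (gf y (∈V y∈)) (path-≅ w' (≅-sym i) p)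

  InJ-≅ : {A A' B B' : IGraph k} → IsIGraph A → IsIGraph B → A ≅ A' → B ≅ B' →
          ∀ {c} → InJ A B c → InJ A' B' c
  InJ-≅ {A} {B = B} wA wB i j ((r , r∈R , φr≡c) , (l , l∈L , φl≡c)) =
      (I.f r , to (I.f-R r r∈V) r∈R , trans (I.f-φ r r∈V) φr≡c)
    , (J.f l , to (J.f-L l l∈V) l∈L , trans (J.f-φ l l∈V) φl≡c)
    where
      module I = _≅_ i
      module J = _≅_ j
      r∈V : r ∈ V A
      r∈V = IsIGraph.R⊆V wA r r∈R
      l∈V : l ∈ V B
      l∈V = IsIGraph.L⊆V wB l l∈L

  module Extension {A A' : IGraph k} (I : A ≅ A') {X : List ℕ} {F : ℕ → ℕ}
      (F-on : ∀ v → v ∈ V A → F v ≡ _≅_.f I v)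
      (F-reflects : ∀ v → v ∈ X → F v ∈ V A' → v ∈ V A) where
    open _≅_ I

    E-extends : IsIGraph A → IsIGraph A' → ∀ x y → x ∈ X → y ∈ X → E A x y ⇔ E A' (F x) (F y)
    E-extends w w' x y x∈ y∈ = mk⇔
      (λ e → let (x∈A , y∈A) = IsIGraph.edge-in-V w x y e in
             subst₂ (E A') (sym (F-on x x∈A)) (sym (F-on y y∈A)) (to (f-E x y x∈A y∈A) e))
      (λ e → let x∈A = F-reflects x x∈ (proj₁ (IsIGraph.edge-in-V w' _ _ e))
                 y∈A = F-reflects y y∈ (proj₂ (IsIGraph.edge-in-V w' _ _ e)) in
             from (f-E x y x∈A y∈A) (subst₂ (E A') (F-on x x∈A) (F-on y y∈A) e))

    subset-extends : {P P' : List ℕ} → (∀ v → v ∈ P → v ∈ V A) → (∀ v → v ∈ P' → v ∈ V A') →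
                     (∀ v → v ∈ V A → (v ∈ P) ⇔ (f v ∈ P')) → ∀ x → x ∈ X → (x ∈ P) ⇔ (F x ∈ P')
    subset-extends {P' = P'} P⊆A P'⊆A' P⇔P' x x∈ = mk⇔
      (λ x∈P → let x∈A = P⊆A x x∈P in
               subst (_∈ P') (sym (F-on x x∈A)) (to (P⇔P' x x∈A) x∈P))
      (λ Fx∈P' → let x∈A = F-reflects x x∈ (P'⊆A' _ Fx∈P') in
                 from (P⇔P' x x∈A) (subst (_∈ P') (F-on x x∈A) Fx∈P'))

  -- The isomorphism of the gluings is I₁ on V G₁ and I₂ on V G₂.  They agree on shared vertices,
  -- since these are the interface vertices with label in J, and isomorphisms preserve J.
  module GlueCong {G₁ G₂ G₁' G₂' : IGraph k}
      (w₁ : IsIGraph G₁) (w₂ : IsIGraph G₂) (w₁' : IsIGraph G₁') (w₂' : IsIGraph G₂')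
      (c : Compatible G₁ G₂) (c' : Compatible G₁' G₂') (I₁ : G₁ ≅ G₁') (I₂ : G₂ ≅ G₂') where
    private
      module I₁ = _≅_ I₁
      module I₂ = _≅_ I₂
      module C  = Compatible c
      module C' = Compatible c'
    open ≡-Reasoning

    InJ⇔ : ∀ {a} → InJ G₁ G₂ a ⇔ InJ G₁' G₂' a
    InJ⇔ = mk⇔ (InJ-≅ w₁ w₂ I₁ I₂) (InJ-≅ w₁' w₂' (≅-sym I₁) (≅-sym I₂))

    shared⇔ˡ : ∀ v → v ∈ V G₂ → (v ∈ V G₁ × v ∈ V G₂) ⇔ (I₂.f v ∈ V G₁' × I₂.f v ∈ V G₂')
    shared⇔ˡ v v∈ = ⇔-trans (C.cap-L v) (⇔-trans
      (I₂.f-L v v∈ ×-⇔ ⇔-trans InJ⇔ (≡⇒ (cong (InJ G₁' G₂') (sym (I₂.f-φ v v∈)))))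
      (⇔-sym (C'.cap-L (I₂.f v))))

    shared⇔ʳ : ∀ v → v ∈ V G₁ → (v ∈ V G₁ × v ∈ V G₂) ⇔ (I₁.f v ∈ V G₁' × I₁.f v ∈ V G₂')
    shared⇔ʳ v v∈ = ⇔-trans (C.cap-R v) (⇔-trans
      (I₁.f-R v v∈ ×-⇔ ⇔-trans InJ⇔ (≡⇒ (cong (InJ G₁' G₂') (sym (I₁.f-φ v v∈)))))
      (⇔-sym (C'.cap-R (I₁.f v))))

    isos-agree : ∀ v → v ∈ V G₁ → v ∈ V G₂ → I₁.f v ≡ I₂.f v
    isos-agree v v∈₁ v∈₂ = IsIGraph.inj-L w₂' _ _ I₁v∈L I₂v∈L labels
      where
        I₁v-shared : I₁.f v ∈ V G₁' × I₁.f v ∈ V G₂'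
        I₁v-shared = to (shared⇔ʳ v v∈₁) (v∈₁ , v∈₂)
        I₁v∈L : I₁.f v ∈ L G₂'
        I₁v∈L = proj₁ (to (C'.cap-L _) I₁v-shared)
        I₂v∈L : I₂.f v ∈ L G₂'
        I₂v∈L = to (I₂.f-L v v∈₂) (proj₁ (to (C.cap-L v) (v∈₁ , v∈₂)))
        labels : φ G₂' (I₁.f v) ≡ φ G₂' (I₂.f v)
        labels = begin
          φ G₂' (I₁.f v) ≡⟨ sym (C'.φ-agree _ (proj₁ I₁v-shared) (proj₂ I₁v-shared)) ⟩
          φ G₁' (I₁.f v) ≡⟨ I₁.f-φ v v∈₁ ⟩
          φ G₁ v         ≡⟨ C.φ-agree v v∈₁ v∈₂ ⟩
          φ G₂ v         ≡⟨ sym (I₂.f-φ v v∈₂) ⟩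
          φ G₂' (I₂.f v) ∎

    F : ℕ → ℕ
    F v with v ∈? V G₁
    ... | yes _ = I₁.f v
    ... | no  _ = I₂.f v

    F-onˡ : ∀ v → v ∈ V G₁ → F v ≡ I₁.f v
    F-onˡ v v∈₁ with v ∈? V G₁
    ... | yes _   = refl
    ... | no  v∉₁ = ⊥-elim (v∉₁ v∈₁)

    F-onʳ : ∀ v → v ∈ V G₂ → F v ≡ I₂.f v
    F-onʳ v v∈₂ with v ∈? V G₁
    ... | yes v∈₁ = isos-agree v v∈₁ v∈₂
    ... | no  _   = refl

    F-reflectsˡ : ∀ v → v ∈ V G₁ ++ V G₂ → F v ∈ V G₁' → v ∈ V G₁
    F-reflectsˡ v v∈ Fv∈ with ∈-++⁻ (V G₁) v∈
    ... | inj₁ v∈₁ = v∈₁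
    ... | inj₂ v∈₂ = proj₁ (from (shared⇔ˡ v v∈₂) (subst (_∈ V G₁') (F-onʳ v v∈₂) Fv∈ , I₂.f-V v v∈₂))

    F-reflectsʳ : ∀ v → v ∈ V G₁ ++ V G₂ → F v ∈ V G₂' → v ∈ V G₂
    F-reflectsʳ v v∈ Fv∈ with ∈-++⁻ (V G₁) v∈
    ... | inj₁ v∈₁ = proj₂ (from (shared⇔ʳ v v∈₁) (I₁.f-V v v∈₁ , subst (_∈ V G₂') (F-onˡ v v∈₁) Fv∈))
    ... | inj₂ v∈₂ = v∈₂

    F-V : ∀ v → v ∈ V G₁ ++ V G₂ → F v ∈ V G₁' ++ V G₂'
    F-V v v∈ with ∈-++⁻ (V G₁) v∈
    ... | inj₁ v∈₁ = subst (_∈ V G₁' ++ V G₂') (sym (F-onˡ v v∈₁)) (∈-++⁺ˡ (I₁.f-V v v∈₁))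
    ... | inj₂ v∈₂ = subst (_∈ V G₁' ++ V G₂') (sym (F-onʳ v v∈₂)) (∈-++⁺ʳ (V G₁') (I₂.f-V v v∈₂))

    F-inverse : (F' : ℕ → ℕ) → (∀ u → u ∈ V G₁' → F' u ≡ I₁.g u) → (∀ u → u ∈ V G₂' → F' u ≡ I₂.g u) →
                ∀ v → v ∈ V G₁ ++ V G₂ → F' (F v) ≡ v
    F-inverse F' F'-onˡ F'-onʳ v v∈ with ∈-++⁻ (V G₁) v∈
    ... | inj₁ v∈₁ = begin
      F' (F v)       ≡⟨ cong F' (F-onˡ v v∈₁) ⟩
      F' (I₁.f v)    ≡⟨ F'-onˡ _ (I₁.f-V v v∈₁) ⟩
      I₁.g (I₁.f v)  ≡⟨ I₁.gf v v∈₁ ⟩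
      v              ∎
    ... | inj₂ v∈₂ = begin
      F' (F v)       ≡⟨ cong F' (F-onʳ v v∈₂) ⟩
      F' (I₂.f v)    ≡⟨ F'-onʳ _ (I₂.f-V v v∈₂) ⟩
      I₂.g (I₂.f v)  ≡⟨ I₂.gf v v∈₂ ⟩
      v              ∎

    F-φ : ∀ v → v ∈ V G₁ ++ V G₂ → φ (glue G₁' G₂') (F v) ≡ φ (glue G₁ G₂) v
    F-φ v v∈ with ∈-++⁻ (V G₁) v∈
    ... | inj₁ v∈₁ = begin
      φ (glue G₁' G₂') (F v)     ≡⟨ cong (φ (glue G₁' G₂')) (F-onˡ v v∈₁) ⟩
      φ (glue G₁' G₂') (I₁.f v)  ≡⟨ φ-glueˡ G₁' G₂' _ (I₁.f-V v v∈₁) ⟩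
      φ G₁' (I₁.f v)             ≡⟨ I₁.f-φ v v∈₁ ⟩
      φ G₁ v                     ≡⟨ sym (φ-glueˡ G₁ G₂ v v∈₁) ⟩
      φ (glue G₁ G₂) v           ∎
    ... | inj₂ v∈₂ = begin
      φ (glue G₁' G₂') (F v)     ≡⟨ cong (φ (glue G₁' G₂')) (F-onʳ v v∈₂) ⟩
      φ (glue G₁' G₂') (I₂.f v)  ≡⟨ φ-glueʳ G₁' G₂' c' _ (I₂.f-V v v∈₂) ⟩
      φ G₂' (I₂.f v)             ≡⟨ I₂.f-φ v v∈₂ ⟩
      φ G₂ v                     ≡⟨ sym (φ-glueʳ G₁ G₂ c v v∈₂) ⟩
      φ (glue G₁ G₂) v           ∎

    module Left  = Extension I₁ F-onˡ F-reflectsˡ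
    module Right = Extension I₂ F-onʳ F-reflectsʳ

  glue-cong : {G₁ G₂ G₁' G₂' : IGraph k} →
    IsIGraph G₁ → IsIGraph G₂ → IsIGraph G₁' → IsIGraph G₂' →
    Compatible G₁ G₂ → Compatible G₁' G₂' → G₁ ≅ G₁' → G₂ ≅ G₂' → glue G₁ G₂ ≅ glue G₁' G₂'
  glue-cong w₁ w₂ w₁' w₂' c c' I₁ I₂ = record
    { f = M.F ; g = N.F
    ; f-V = M.F-V ; g-V = N.F-V
    ; gf = M.F-inverse N.F N.F-onˡ N.F-onʳ
    ; fg = N.F-inverse M.F M.F-onˡ M.F-onʳ
    ; f-E = λ x y x∈ y∈ → M.Left.E-extends w₁ w₁' x y x∈ y∈ ⊎-⇔ M.Right.E-extends w₂ w₂' x y x∈ y∈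
    ; f-φ = M.F-φ
    ; f-L = M.Left.subset-extends (IsIGraph.L⊆V w₁) (IsIGraph.L⊆V w₁') (_≅_.f-L I₁)
    ; f-R = M.Right.subset-extends (IsIGraph.R⊆V w₂) (IsIGraph.R⊆V w₂') (_≅_.f-R I₂)
    }
    where
      module M = GlueCong w₁ w₂ w₁' w₂' c c' I₁ I₂
      module N = GlueCong w₁' w₂' w₁ w₂ c' c (≅-sym I₁) (≅-sym I₂)

  abs-glue-cong : {G₁ G₂ G₁' G₂' : IGraph k} →
    IsIGraph G₁ → IsIGraph G₂ → IsIGraph G₁' → IsIGraph G₂' →
    Compatible G₁ G₂ → Compatible G₁' G₂' → G₁ ≅ G₁' → G₂ ≅ G₂' →
    abs (glue G₁ G₂) ≅ abs (glue G₁' G₂')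
  abs-glue-cong w₁ w₂ w₁' w₂' c c' I₁ I₂ =
    abs-cong (glue-IsIGraph w₁ w₂ c) (glue-IsIGraph w₁' w₂' c') (glue-cong w₁ w₂ w₁' w₂' c c' I₁ I₂)

  ×-⇔-pointwise : {A B C : Set} → (A → B ⇔ C) → (A × B) ⇔ (A × C)
  ×-⇔-pointwise B⇔C = mk⇔ (λ (a , b) → a , to (B⇔C a) b) (λ (a , c) → a , from (B⇔C a) c)

  module _ {G H : IGraph k} (w : IsIGraph G) where

    Compatible-absˡ : Compatible G H → Compatible (abs G) H
    Compatible-absˡ c = record
      { cap-R   = λ v → ⇔-trans (shared v) (Compatible.cap-R c v)
      ; cap-L   = λ v → ⇔-trans (shared v) (Compatible.cap-L c v)
      ; φ-agree = λ v v∈ → Compatible.φ-agree c v (interface⊆V w v v∈)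
      }
      where
        shared : ∀ v → (v ∈ L G ++ R G × v ∈ V H) ⇔ (v ∈ V G × v ∈ V H)
        shared v = mk⇔ (λ (v∈ , v∈H) → interface⊆V w v v∈ , v∈H)
                       (λ v∈GH → ∈-++⁺ʳ (L G) (proj₁ (to (Compatible.cap-R c v) v∈GH)) , proj₂ v∈GH)

    Compatible-absʳ : Compatible H G → Compatible H (abs G)
    Compatible-absʳ c = record
      { cap-R   = λ v → ⇔-trans (shared v) (Compatible.cap-R c v)
      ; cap-L   = λ v → ⇔-trans (shared v) (Compatible.cap-L c v)
      ; φ-agree = λ v v∈H v∈ → Compatible.φ-agree c v v∈H (interface⊆V w v v∈)
      }
      where
        shared : ∀ v → (v ∈ V H × v ∈ L G ++ R G) ⇔ (v ∈ V H × v ∈ V G)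
        shared v = mk⇔ (λ (v∈H , v∈) → v∈H , interface⊆V w v v∈)
                       (λ v∈HG → proj₁ v∈HG , ∈-++⁺ˡ (proj₁ (to (Compatible.cap-L c v) v∈HG)))

  InJ-glueˡ : {H₁ H₂ H₃ : IGraph k} → IsIGraph H₂ → Compatible H₁ H₂ →
              ∀ {a} → InJ H₂ H₃ a ⇔ InJ (glue H₁ H₂) H₃ a
  InJ-glueˡ {H₁} {H₂} w₂ c = mk⇔
    (λ ((r , r∈ , φr≡a) , l) → (r , r∈ , trans (φ≡ r r∈) φr≡a) , l)
    (λ ((r , r∈ , φr≡a) , l) → (r , r∈ , trans (sym (φ≡ r r∈)) φr≡a) , l)
    where
      φ≡ : ∀ r → r ∈ R H₂ → φ (glue H₁ H₂) r ≡ φ H₂ r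
      φ≡ r r∈ = φ-glueʳ H₁ H₂ c r (IsIGraph.R⊆V w₂ r r∈)

  InJ-glueʳ : {H₁ H₂ H₃ : IGraph k} → IsIGraph H₂ →
              ∀ {a} → InJ H₁ H₂ a ⇔ InJ H₁ (glue H₂ H₃) a
  InJ-glueʳ {H₂ = H₂} {H₃} w₂ = mk⇔
    (λ (r , (l , l∈ , φl≡a)) → r , (l , l∈ , trans (φ≡ l l∈) φl≡a))
    (λ (r , (l , l∈ , φl≡a)) → r , (l , l∈ , trans (sym (φ≡ l l∈)) φl≡a))
    where
      φ≡ : ∀ l → l ∈ L H₂ → φ (glue H₂ H₃) l ≡ φ H₂ l
      φ≡ l l∈ = φ-glueˡ H₂ H₃ l (IsIGraph.L⊆V w₂ l l∈)

  module _ {H₁ H₂ H₃ : IGraph k} (w₂ : IsIGraph H₂) (s : CompatibleSeq3 H₁ H₂ H₃) where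
    open CompatibleSeq3 s
    private
      module C₁ = Compatible c₁₂
      module C₂ = Compatible c₂₃

    shared-glueˡ : ∀ v → (v ∈ V H₁ ++ V H₂ × v ∈ V H₃) ⇔ (v ∈ V H₂ × v ∈ V H₃)
    shared-glueˡ v = mk⇔
      (λ (v∈ , v∈₃) → [ (λ v∈₁ → mid v v∈₁ v∈₃) , id ]′ (∈-++⁻ (V H₁) v∈) , v∈₃)
      (λ (v∈₂ , v∈₃) → ∈-++⁺ʳ (V H₁) v∈₂ , v∈₃)

    shared-glueʳ : ∀ v → (v ∈ V H₁ × v ∈ V H₂ ++ V H₃) ⇔ (v ∈ V H₁ × v ∈ V H₂)
    shared-glueʳ v = mk⇔
      (λ (v∈₁ , v∈) → v∈₁ , [ id , mid v v∈₁ ]′ (∈-++⁻ (V H₂) v∈))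
      (λ (v∈₁ , v∈₂) → v∈₁ , ∈-++⁺ˡ v∈₂)

    private
      InJ-glueˡ⇔ : ∀ {a} → InJ H₂ H₃ a ⇔ InJ (glue H₁ H₂) H₃ a
      InJ-glueˡ⇔ = InJ-glueˡ {H₃ = H₃} w₂ c₁₂

      InJ-glueʳ⇔ : ∀ {a} → InJ H₁ H₂ a ⇔ InJ H₁ (glue H₂ H₃) a
      InJ-glueʳ⇔ = InJ-glueʳ {H₁ = H₁} w₂

    Compatible-glueˡ : Compatible (glue H₁ H₂) H₃
    Compatible-glueˡ = record
      { cap-R   = λ v → ⇔-trans (shared-glueˡ v) (⇔-trans (C₂.cap-R v) (×-⇔-pointwise λ v∈R →
                    ⇔-trans InJ-glueˡ⇔ (≡⇒ (cong (InJ (glue H₁ H₂) H₃)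
                                              (sym (φ-glueʳ H₁ H₂ c₁₂ v (IsIGraph.R⊆V w₂ v v∈R)))))))
      ; cap-L   = λ v → ⇔-trans (shared-glueˡ v) (⇔-trans (C₂.cap-L v) (⇔-refl ×-⇔ InJ-glueˡ⇔))
      ; φ-agree = λ v v∈ v∈₃ → let v∈₂ = proj₁ (to (shared-glueˡ v) (v∈ , v∈₃)) in
                  trans (φ-glueʳ H₁ H₂ c₁₂ v v∈₂) (C₂.φ-agree v v∈₂ v∈₃)
      }

    Compatible-glueʳ : Compatible H₁ (glue H₂ H₃)
    Compatible-glueʳ = record
      { cap-R   = λ v → ⇔-trans (shared-glueʳ v) (⇔-trans (C₁.cap-R v) (⇔-refl ×-⇔ InJ-glueʳ⇔))
      ; cap-L   = λ v → ⇔-trans (shared-glueʳ v) (⇔-trans (C₁.cap-L v) (×-⇔-pointwise λ v∈L →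
                    ⇔-trans InJ-glueʳ⇔ (≡⇒ (cong (InJ H₁ (glue H₂ H₃))
                                              (sym (φ-glueˡ H₂ H₃ v (IsIGraph.L⊆V w₂ v v∈L)))))))
      ; φ-agree = λ v v∈₁ v∈ → let v∈₂ = proj₂ (to (shared-glueʳ v) (v∈₁ , v∈)) in
                  trans (C₁.φ-agree v v∈₁ v∈₂) (sym (φ-glueˡ H₂ H₃ v v∈₂))
      }

  path-glue-swap : (A B : IGraph k) {X : List ℕ} →
                   ∀ {x y} → OutsidePath (glue A B) X x y → OutsidePath (glue B A) X x y
  path-glue-swap A B = path-map swap (λ z∈ z∉ → ∈-resp-↭ (++-comm (V A) (V B)) z∈ , z∉)

  path-glue-comm : (A B : IGraph k) {X : List ℕ} →
                   ∀ {x y} → OutsidePath (glue A B) X x y ⇔ OutsidePath (glue B A) X x y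
  path-glue-comm A B = mk⇔ (path-glue-swap A B) (path-glue-swap B A)

  torso-edge⇔ : {A B : IGraph k} {X : List ℕ} →
    (∀ {x y} → x ∈ X → y ∈ X → x ≢ y → OutsidePath A X x y ⇔ OutsidePath B X x y) →
    ∀ x y → (x ∈ X × y ∈ X × x ≢ y × OutsidePath A X x y) ⇔ (x ∈ X × y ∈ X × x ≢ y × OutsidePath B X x y)
  torso-edge⇔ P⇔ x y = mk⇔
    (λ (x∈ , y∈ , x≢y , p) → x∈ , y∈ , x≢y , to   (P⇔ x∈ y∈ x≢y) p)
    (λ (x∈ , y∈ , x≢y , p) → x∈ , y∈ , x≢y , from (P⇔ x∈ y∈ x≢y) p)

  module Torso {G H : IGraph k} (wG : IsIGraph G) (wH : IsIGraph H)
      (separated : ∀ v → v ∈ V G → v ∈ V H → v ∈ L G ++ R G)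
      {Y : List ℕ} (Y⊆ : ∀ y → y ∈ Y → y ∈ L G ++ R G ⊎ y ∈ V H) where

    private
      S : List ℕ
      S = L G ++ R G

    Y∩G⊆S : ∀ {y} → y ∈ Y → y ∈ V G → y ∈ S
    Y∩G⊆S y∈Y y∈G = [ id , separated _ y∈G ]′ (Y⊆ _ y∈Y)

    private
      V-expand : ∀ {z} → z ∈ S ++ V H → z ∈ V G ++ V H
      V-expand z∈ = [ ∈-++⁺ˡ ∘ interface⊆V wG _ , ∈-++⁺ʳ (V G) ]′ (∈-++⁻ S z∈)

      embed : ∀ {a b} → OutsidePath G S a b → OutsidePath (glue G H) Y a b
      embed = path-map inj₁ (λ z∈G z∉S → ∈-++⁺ˡ z∈G , λ z∈Y → z∉S (Y∩G⊆S z∈Y z∈G))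

    expand : ∀ {a b} → OutsidePath (glue (abs G) H) Y a b → OutsidePath (glue G H) Y a b
    expand (edge (inj₁ (_ , _ , _ , p)))        = embed p
    expand (edge (inj₂ e))                      = edge (inj₂ e)
    expand (step (inj₁ (_ , _ , _ , p)) z∈ z∉ q) = path-join (embed p) (V-expand z∈) z∉ (expand q)
    expand (step (inj₂ e) z∈ z∉ q)              = step (inj₂ e) (V-expand z∈) z∉ (expand q)

    -- Reflexive closure: a walk a → b → a through G contracts to nothing, the torso having no loops.
    _⇝_ : ℕ → ℕ → Set
    a ⇝ b = a ≡ b ⊎ OutsidePath (glue (abs G) H) Y a b

    ⇝-join : ∀ {a b c} → a ⇝ b → b ∈ S ++ V H → b ∉ Y → b ⇝ c → a ⇝ c
    ⇝-join (inj₁ refl) _  _  q           = q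
    ⇝-join (inj₂ p)    _  _  (inj₁ refl) = inj₂ p
    ⇝-join (inj₂ p)    b∈ b∉ (inj₂ q)    = inj₂ (path-join p b∈ b∉ q)

    abs-edge : ∀ {a b} → a ∈ S → b ∈ S → OutsidePath G S a b → a ⇝ b
    abs-edge {a} {b} a∈ b∈ p with a ≟ b
    ... | yes a≡b = inj₁ a≡b
    ... | no  a≢b = inj₂ (edge (inj₁ (a∈ , b∈ , a≢b , p)))

    private
      ∈S : ∀ {a} → a ∈ S ⊎ a ∈ V H → a ∈ V G → a ∈ S
      ∈S a∈ a∈G = [ id , separated _ a∈G ]′ a∈

      ends-G : ∀ {x y} → E G x y → x ∈ V G × y ∈ V G
      ends-G = IsIGraph.edge-in-V wG _ _

      stays-in-G : ∀ {b c} → b ∈ V G → b ∉ S → ¬ E H b c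
      stays-in-G b∈G b∉S e = b∉S (separated _ b∈G (proj₁ (IsIGraph.edge-in-V wH _ _ e)))

    mutual
      contract-from : ∀ {a y} → a ∈ S ⊎ a ∈ V H → OutsidePath (glue G H) Y a y → y ∈ Y → a ⇝ y
      contract-from a∈ (edge (inj₁ e)) y∈Y =
        abs-edge (∈S a∈ (proj₁ (ends-G e))) (Y∩G⊆S y∈Y (proj₂ (ends-G e))) (edge e)
      contract-from a∈ (edge (inj₂ e)) _ = inj₂ (edge (inj₂ e))
      contract-from a∈ (step (inj₁ e) _ z∉ p) y∈Y =
        contract-segment (∈S a∈ (proj₁ (ends-G e))) (edge e) (proj₂ (ends-G e)) z∉ p y∈Y
      contract-from a∈ (step (inj₂ e) _ z∉ p) y∈Y =
        ⇝-join (inj₂ (edge (inj₂ e))) (∈-++⁺ʳ S (proj₂ (IsIGraph.edge-in-V wH _ _ e))) z∉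
               (contract-from (inj₂ (proj₂ (IsIGraph.edge-in-V wH _ _ e))) p y∈Y)

      -- r is the stretch of the walk inside G since its last visit to S, at a.
      contract-segment : ∀ {a b y} → a ∈ S → OutsidePath G S a b → b ∈ V G → b ∉ Y →
                         OutsidePath (glue G H) Y b y → y ∈ Y → a ⇝ y
      contract-segment {b = b} a∈S r b∈G b∉Y p y∈Y with b ∈? S | p
      ... | yes b∈S | p' =
        ⇝-join (abs-edge a∈S b∈S r) (∈-++⁺ˡ b∈S) b∉Y (contract-from (inj₁ b∈S) p' y∈Y)
      ... | no b∉S | edge (inj₁ e) =
        abs-edge a∈S (Y∩G⊆S y∈Y (proj₂ (ends-G e))) (path-join r b∈G b∉S (edge e))
      ... | no b∉S | step (inj₁ e) _ z∉ q =
        contract-segment a∈S (path-join r b∈G b∉S (edge e)) (proj₂ (ends-G e)) z∉ q y∈Y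
      ... | no b∉S | edge (inj₂ e)       = ⊥-elim (stays-in-G b∈G b∉S e)
      ... | no b∉S | step (inj₂ e) _ _ _ = ⊥-elim (stays-in-G b∈G b∉S e)

    outside⇔ : ∀ {x y} → x ∈ Y → y ∈ Y → x ≢ y →
               OutsidePath (glue (abs G) H) Y x y ⇔ OutsidePath (glue G H) Y x y
    outside⇔ x∈ y∈ x≢y = mk⇔ expand contract
      where
        contract : OutsidePath (glue G H) Y _ _ → OutsidePath (glue (abs G) H) Y _ _
        contract p with contract-from (Y⊆ _ x∈) p y∈
        ... | inj₁ x≡y = ⊥-elim (x≢y x≡y)
        ... | inj₂ q   = q

  abs-glue-absˡ : {G H : IGraph k} → IsIGraph G → IsIGraph H → Compatible G H →
                  abs (glue (abs G) H) ≅ abs (glue G H)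
  abs-glue-absˡ {G} {H} wG wH c =
    ≅-byId (λ _ → ⇔-refl) (torso-edge⇔ T.outside⇔) φ≡ (λ _ → ⇔-refl) (λ _ → ⇔-refl)
    where
      separated : ∀ v → v ∈ V G → v ∈ V H → v ∈ L G ++ R G
      separated v v∈G v∈H = ∈-++⁺ʳ (L G) (proj₁ (to (Compatible.cap-R c v) (v∈G , v∈H)))
      Y⊆ : ∀ y → y ∈ L G ++ R H → y ∈ L G ++ R G ⊎ y ∈ V H
      Y⊆ y y∈ = [ inj₁ ∘ ∈-++⁺ˡ , inj₂ ∘ IsIGraph.R⊆V wH y ]′ (∈-++⁻ (L G) y∈)
      module T = Torso wG wH separated Y⊆
      φ≡ : ∀ x → x ∈ L G ++ R H → φ (glue G H) x ≡ φ (glue (abs G) H) x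
      φ≡ x x∈ = by-cases (x ∈? L G ++ R G)
        where
          by-cases : Dec (x ∈ L G ++ R G) → φ (glue G H) x ≡ φ (glue (abs G) H) x
          by-cases (yes x∈S) =
            trans (φ-glueˡ G H x (interface⊆V wG x x∈S)) (sym (φ-glueˡ (abs G) H x x∈S))
          by-cases (no  x∉S) =
            trans (φ-glue-∉ G H x (x∉S ∘ T.Y∩G⊆S x∈)) (sym (φ-glue-∉ (abs G) H x x∉S))

  abs-glue-absʳ : {H G : IGraph k} → IsIGraph H → IsIGraph G → Compatible H G →
                  abs (glue H (abs G)) ≅ abs (glue H G)
  abs-glue-absʳ {H} {G} wH wG c =
    ≅-byId (λ _ → ⇔-refl) (torso-edge⇔ outside⇔) (λ x _ → φ≡ x) (λ _ → ⇔-refl) (λ _ → ⇔-refl)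
    where
      separated : ∀ v → v ∈ V G → v ∈ V H → v ∈ L G ++ R G
      separated v v∈G v∈H = ∈-++⁺ˡ (proj₁ (to (Compatible.cap-L c v) (v∈H , v∈G)))
      Y⊆ : ∀ y → y ∈ L H ++ R G → y ∈ L G ++ R G ⊎ y ∈ V H
      Y⊆ y y∈ = [ inj₂ ∘ IsIGraph.L⊆V wH y , inj₁ ∘ ∈-++⁺ʳ (L G) ]′ (∈-++⁻ (L H) y∈)
      module T = Torso wG wH separated Y⊆
      outside⇔ : ∀ {x y} → x ∈ L H ++ R G → y ∈ L H ++ R G → x ≢ y →
        OutsidePath (glue H (abs G)) (L H ++ R G) x y ⇔ OutsidePath (glue H G) (L H ++ R G) x y
      outside⇔ x∈ y∈ x≢y =
        ⇔-trans (path-glue-comm H (abs G)) (⇔-trans (T.outside⇔ x∈ y∈ x≢y) (path-glue-comm G H))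
      φ≡ : ∀ x → φ (glue H G) x ≡ φ (glue H (abs G)) x
      φ≡ x = by-cases (x ∈? V H)
        where
          by-cases : Dec (x ∈ V H) → φ (glue H G) x ≡ φ (glue H (abs G)) x
          by-cases (yes x∈H) = trans (φ-glueˡ H G x x∈H) (sym (φ-glueˡ H (abs G) x x∈H))
          by-cases (no  x∉H) = trans (φ-glue-∉ H G x x∉H) (sym (φ-glue-∉ H (abs G) x x∉H))

  glue-assoc : (H₁ H₂ H₃ : IGraph k) → glue (glue H₁ H₂) H₃ ≅ glue H₁ (glue H₂ H₃)
  glue-assoc H₁ H₂ H₃ =
    ≅-byId (λ x → ≡⇒ (cong (x ∈_) (++-assoc (V H₁) (V H₂) (V H₃))))
           (λ _ _ → mk⇔ assocʳ assocˡ) (λ x _ → φ≡ x) (λ _ → ⇔-refl) (λ _ → ⇔-refl)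
    where
      open ≡-Reasoning
      φ≡ : ∀ x → φ (glue H₁ (glue H₂ H₃)) x ≡ φ (glue (glue H₁ H₂) H₃) x
      φ≡ x = by-cases (x ∈? V H₁) (x ∈? V H₂)
        where
          by-cases : Dec (x ∈ V H₁) → Dec (x ∈ V H₂) →
                     φ (glue H₁ (glue H₂ H₃)) x ≡ φ (glue (glue H₁ H₂) H₃) x
          by-cases (yes x∈₁) _ = begin
            φ (glue H₁ (glue H₂ H₃)) x  ≡⟨ φ-glueˡ H₁ (glue H₂ H₃) x x∈₁ ⟩
            φ H₁ x                      ≡⟨ sym (φ-glueˡ H₁ H₂ x x∈₁) ⟩
            φ (glue H₁ H₂) x            ≡⟨ sym (φ-glueˡ (glue H₁ H₂) H₃ x (∈-++⁺ˡ x∈₁)) ⟩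
            φ (glue (glue H₁ H₂) H₃) x  ∎
          by-cases (no x∉₁) (yes x∈₂) = begin
            φ (glue H₁ (glue H₂ H₃)) x  ≡⟨ φ-glue-∉ H₁ (glue H₂ H₃) x x∉₁ ⟩
            φ (glue H₂ H₃) x            ≡⟨ φ-glueˡ H₂ H₃ x x∈₂ ⟩
            φ H₂ x                      ≡⟨ sym (φ-glue-∉ H₁ H₂ x x∉₁) ⟩
            φ (glue H₁ H₂) x            ≡⟨ sym (φ-glueˡ (glue H₁ H₂) H₃ x (∈-++⁺ʳ (V H₁) x∈₂)) ⟩
            φ (glue (glue H₁ H₂) H₃) x  ∎
          by-cases (no x∉₁) (no x∉₂) = begin
            φ (glue H₁ (glue H₂ H₃)) x  ≡⟨ φ-glue-∉ H₁ (glue H₂ H₃) x x∉₁ ⟩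
            φ (glue H₂ H₃) x            ≡⟨ φ-glue-∉ H₂ H₃ x x∉₂ ⟩
            φ H₃ x                      ≡⟨ sym (φ-glue-∉ (glue H₁ H₂) H₃ x x∉₁₂) ⟩
            φ (glue (glue H₁ H₂) H₃) x  ∎
            where
              x∉₁₂ : x ∉ V H₁ ++ V H₂
              x∉₁₂ = [ x∉₁ , x∉₂ ]′ ∘ ∈-++⁻ (V H₁)

  BoxSum-unique : {A B C H₁ H₂ : IGraph k} → BoxSum A B C →
    IsIGraph H₁ → IsIGraph H₂ → Compatible H₁ H₂ → H₁ ≅ A → H₂ ≅ B → abs (glue H₁ H₂) ≅ C
  BoxSum-unique (A' , B' , wA' , wB' , A'≅A , B'≅B , c' , abs≅C) w₁ w₂ c H₁≅A H₂≅B =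
    ≅-trans (abs-glue-cong w₁ w₂ wA' wB' c c' (≅-trans H₁≅A (≅-sym A'≅A)) (≅-trans H₂≅B (≅-sym B'≅B)))
            abs≅C

mainTheorem3 : (k : ℕ) → 0 < k →
    (A₁ A₂ A₃ : IGraph k) → InAbs A₁ → InAbs A₂ → InAbs A₃ →
    (B₁₂ C B₂₃ C' T : IGraph k) →
    BoxSum A₁ A₂ B₁₂ → BoxSum B₁₂ A₃ C →
    BoxSum A₂ A₃ B₂₃ → BoxSum A₁ B₂₃ C' →
    AbsSum3 A₁ A₂ A₃ T →
    (C ≅ T) × (T ≅ C')
mainTheorem3 k _ A₁ A₂ A₃ _ _ _ B₁₂ C B₂₃ C' T σ₁₂ σ₁₂₋₃ σ₂₃ σ₁₋₂₃
  (H₁ , H₂ , H₃ , w₁ , w₂ , w₃ , H₁≅A₁ , H₂≅A₂ , H₃≅A₃ , s , abs≅T) =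
    ≅-trans (≅-sym C-rep) (≅-trans (abs-glue-absˡ w₁₂ w₃ c₁₂₋₃) abs≅T)
  , ≅-trans (≅-sym abs≅T) (≅-trans assoc (≅-trans (≅-sym (abs-glue-absʳ w₁ w₂₃ c₁₋₂₃)) C'-rep))
  where
    open CompatibleSeq3 s
    w₁₂ : IsIGraph (glue H₁ H₂)
    w₁₂ = glue-IsIGraph w₁ w₂ c₁₂
    w₂₃ : IsIGraph (glue H₂ H₃)
    w₂₃ = glue-IsIGraph w₂ w₃ c₂₃
    c₁₂₋₃ : Compatible (glue H₁ H₂) H₃
    c₁₂₋₃ = Compatible-glueˡ w₂ s
    c₁₋₂₃ : Compatible H₁ (glue H₂ H₃)
    c₁₋₂₃ = Compatible-glueʳ w₂ s
    assoc : abs (glue (glue H₁ H₂) H₃) ≅ abs (glue H₁ (glue H₂ H₃))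
    assoc = abs-cong (glue-IsIGraph w₁₂ w₃ c₁₂₋₃) (glue-IsIGraph w₁ w₂₃ c₁₋₂₃) (glue-assoc H₁ H₂ H₃)
    C-rep : abs (glue (abs (glue H₁ H₂)) H₃) ≅ C
    C-rep = BoxSum-unique σ₁₂₋₃ (abs-IsIGraph w₁₂) w₃ (Compatible-absˡ w₁₂ c₁₂₋₃)
              (BoxSum-unique σ₁₂ w₁ w₂ c₁₂ H₁≅A₁ H₂≅A₂) H₃≅A₃
    C'-rep : abs (glue H₁ (abs (glue H₂ H₃))) ≅ C'
    C'-rep = BoxSum-unique σ₁₋₂₃ w₁ (abs-IsIGraph w₂₃) (Compatible-absʳ w₂₃ c₁₋₂₃) H₁≅A₁
               (BoxSum-unique σ₂₃ w₂ w₃ c₂₃ H₂≅A₂ H₃≅A₃)
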